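{- Let $G=(V,E)$ be a graph and let $A,B$ be offensive alliances of $G$ such that there is an offensive alliance TM sequence between $A$ and $B$, for some $\mathrm{TM}\in\{\text{TAR},\text{TJ}\}$. Then $Y(A)=Y(B)$.
   Context: For $X\subseteq V$: $N[X]=X\cup\bigcup_{v\in X}N(v)$, $\partial X=N[X]\setminus X$, $d_X(v)=|N(v)\cap X|$. $X$ is an offensive alliance if $d_X(v)\ge d_{V\setminus X}(v)+1$ for all $v\in\partial X$. Let $L=\{x\in V\mid d_G(x)=1\}$ be the set of leaves, $Z(X)=\{v\in V\setminus N[X]\mid N(v)\subseteq L\cup\partial X\}$, and $Y(X)=N[X]\cup Z(X)\cup L$. $B$ is obtained from $A$ by a token jumping (TJ) step if $|A|=|B|$ and $|A\setminus B|=1$; by a token addition/removal (TAR) step if one of $A,B$ arises from the other by adding exactly one vertex. An offensive alliance TM sequence is a sequence of offensive alliances with consecutive sets differing by a TM step. -}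

module Defs where

open import Data.Nat using (ℕ; _≥_; _+_)
open import Data.Bool using (Bool; true; false)
open import Data.Fin using (Fin)
open import Data.Fin.Subset using (Subset; _∈_; _∉_; _∩_; _∪_; ∁; ∣_∣; ⁅_⁆)
open import Data.Vec using (tabulate)
open import Data.Product using (Σ; _×_; ∃)
open import Data.Sum using (_⊎_)
open import Relation.Nullary using (¬_)
open import Relation.Binary.PropositionalEquality using (_≡_)

record Graph (n : ℕ) : Set where
  field
    adj   : Fin n → Fin n → Bool
    sym   : ∀ u v → adj u v ≡ adj v u
    irrefl : ∀ v → adj v v ≡ false

module _ {n : ℕ} (G : Graph n) where
  open Graph G

  Adj : Fin n → Fin n → Set
  Adj u v = adj u v ≡ true

  N : Fin n → Subset n
  N v = tabulate (adj v)

  deg : Subset n → Fin n → ℕ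
  deg X v = ∣ N v ∩ X ∣

  degG : Fin n → ℕ
  degG v = ∣ N v ∣

  InN[_] : Subset n → Fin n → Set
  InN[ X ] v = v ∈ X ⊎ Σ (Fin n) (λ u → u ∈ X × Adj u v)

  In∂ : Subset n → Fin n → Set
  In∂ X v = InN[ X ] v × v ∉ X

  OffensiveAlliance : Subset n → Set
  OffensiveAlliance X = ∀ v → In∂ X v → deg X v ≥ deg (∁ X) v + 1

  InL : Fin n → Set
  InL x = degG x ≡ 1

  InZ : Subset n → Fin n → Set
  InZ X v = (¬ InN[ X ] v) × (∀ u → Adj v u → InL u ⊎ In∂ X u)

  InY : Subset n → Fin n → Set
  InY X v = InN[ X ] v ⊎ InZ X v ⊎ InL v

  TJStep : Subset n → Subset n → Set
  TJStep A B = (∣ A ∣ ≡ ∣ B ∣) × (∣ A ∩ ∁ B ∣ ≡ 1)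

  AddOne : Subset n → Subset n → Set
  AddOne A B = Σ (Fin n) (λ v → v ∉ A × B ≡ A ∪ ⁅ v ⁆)

  TARStep : Subset n → Subset n → Set
  TARStep A B = AddOne A B ⊎ AddOne B A

data TM : Set where
  TAR TJ : TM

Step : {n : ℕ} → Graph n → TM → Subset n → Subset n → Set
Step G TAR = TARStep G
Step G TJ  = TJStep G

data OASeq {n : ℕ} (G : Graph n) (tm : TM) : Subset n → Subset n → Set where
  single : ∀ {A} → OffensiveAlliance G A → OASeq G tm A A
  cons   : ∀ {A B C} → OffensiveAlliance G A → Step G tm A B →
           OASeq G tm B C → OASeq G tm A C

-- Let M(X) = N[X] ∪ L. If B is an offensive alliance and B ⊆ A ∪ {y}, then every
-- neighbour w of y outside N[A] is a leaf: y is its only attacker in B, so the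
-- alliance inequality 1 ≥ d_B(w) ≥ d_{V∖B}(w) + 1 forces deg w = 1. Hence every
-- vertex of N[B] lies in M(A) or has its whole neighbourhood in M(A), and this
-- already gives Y(B) ⊆ Y(A). Both TAR and TJ steps put each of the two sets inside
-- the other plus one vertex, so Y is constant along an alliance sequence.
module Submission where

open import Defs
open import Data.Nat using (ℕ; zero; suc; pred; _+_; _≤_; z≤n; s≤s)
open import Data.Nat.Properties using (+-suc; +-cancelˡ-≡; m+n≤o⇒n≤o; ≤-trans)
  renaming (_≟_ to _≟ℕ_)
open import Data.Fin using (Fin; zero; suc)
open import Data.Fin.Subset
  using (Subset; _∈_; _∉_; _⊆_; _∩_; _∪_; ∁; ∣_∣; ⁅_⁆; inside; outside)
open import Data.Fin.Subset.Properties
  using (_∈?_; x∈⁅x⁆; x∈⁅y⁆⇒x≡y; ∣⁅x⁆∣≡1; p⊆q⇒∣p∣≤∣q∣; x∈p∩q⁺; x∈p∩q⁻;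
         x∉p⇒x∈∁p; x∈p∪q⁺; x∈p∪q⁻; p⊆p∪q; ∩-comm)
open import Data.Fin.Properties using (any?)
open import Data.Vec using ([]; _∷_; here; there)
open import Data.Vec.Properties using (lookup∘tabulate; []=⇒lookup)
open import Data.Bool using (true)
import Data.Bool as Bool
open import Data.Product using (_×_; _,_; ∃)
open import Data.Sum using (_⊎_; inj₁; inj₂; [_,_])
open import Data.Empty using (⊥-elim)
open import Relation.Nullary using (¬_; Dec; yes; no)
open import Relation.Nullary.Decidable using (_⊎-dec_; _×-dec_)
open import Relation.Binary.PropositionalEquality
  using (_≡_; refl; sym; trans; cong; subst; module ≡-Reasoning)

∣p∣≡∣p∩q∣+∣p∩∁q∣ : ∀ {m} (p q : Subset m) → ∣ p ∣ ≡ ∣ p ∩ q ∣ + ∣ p ∩ ∁ q ∣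
∣p∣≡∣p∩q∣+∣p∩∁q∣ []            []            = refl
∣p∣≡∣p∩q∣+∣p∩∁q∣ (outside ∷ p) (_       ∷ q) = ∣p∣≡∣p∩q∣+∣p∩∁q∣ p q
∣p∣≡∣p∩q∣+∣p∩∁q∣ (inside  ∷ p) (inside  ∷ q) = cong suc (∣p∣≡∣p∩q∣+∣p∩∁q∣ p q)
∣p∣≡∣p∩q∣+∣p∩∁q∣ (inside  ∷ p) (outside ∷ q) =
  trans (cong suc (∣p∣≡∣p∩q∣+∣p∩∁q∣ p q)) (sym (+-suc _ _))

∣p∣≡∣q∣⇒∣p∩∁q∣≡∣q∩∁p∣ : ∀ {m} (p q : Subset m) → ∣ p ∣ ≡ ∣ q ∣ → ∣ p ∩ ∁ q ∣ ≡ ∣ q ∩ ∁ p ∣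
∣p∣≡∣q∣⇒∣p∩∁q∣≡∣q∩∁p∣ p q eq = +-cancelˡ-≡ ∣ p ∩ q ∣ _ _ (begin
  ∣ p ∩ q ∣ + ∣ p ∩ ∁ q ∣ ≡⟨ sym (∣p∣≡∣p∩q∣+∣p∩∁q∣ p q) ⟩
  ∣ p ∣                   ≡⟨ eq ⟩
  ∣ q ∣                   ≡⟨ ∣p∣≡∣p∩q∣+∣p∩∁q∣ q p ⟩
  ∣ q ∩ p ∣ + ∣ q ∩ ∁ p ∣ ≡⟨ cong (_+ ∣ q ∩ ∁ p ∣) (cong ∣_∣ (∩-comm q p)) ⟩
  ∣ p ∩ q ∣ + ∣ q ∩ ∁ p ∣ ∎)
  where open ≡-Reasoning

∣p∣≡0⇒x∉p : ∀ {m} (p : Subset m) → ∣ p ∣ ≡ 0 → ∀ {x} → x ∉ p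
∣p∣≡0⇒x∉p (outside ∷ p) eq (there x∈p) = ∣p∣≡0⇒x∉p p eq x∈p

∣p∣≡1⇒p⊆⁅x⁆ : ∀ {m} (p : Subset m) → ∣ p ∣ ≡ 1 → ∃ λ x → p ⊆ ⁅ x ⁆
∣p∣≡1⇒p⊆⁅x⁆ (inside  ∷ p) eq = zero , λ
  { here        → here
  ; (there x∈p) → ⊥-elim (∣p∣≡0⇒x∉p p (cong pred eq) x∈p) }
∣p∣≡1⇒p⊆⁅x⁆ (outside ∷ p) eq with ∣p∣≡1⇒p⊆⁅x⁆ p eq
... | x , p⊆⁅x⁆ = suc x , λ { (there y∈p) → there (p⊆⁅x⁆ y∈p) }

p∩∁q⊆r⇒p⊆q∪r : ∀ {m} {p q r : Subset m} → p ∩ ∁ q ⊆ r → p ⊆ q ∪ r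
p∩∁q⊆r⇒p⊆q∪r {q = q} p∩∁q⊆r {x} x∈p with x ∈? q
... | yes x∈q = x∈p∪q⁺ (inj₁ x∈q)
... | no  x∉q = x∈p∪q⁺ (inj₂ (p∩∁q⊆r (x∈p∩q⁺ (x∈p , x∉p⇒x∈∁p x∉q))))

n+1≤m≤1⇒m+n≡1 : ∀ {m n} → n + 1 ≤ m → m ≤ 1 → m + n ≡ 1
n+1≤m≤1⇒m+n≡1 {n = zero}  (s≤s _) (s≤s z≤n) = refl
n+1≤m≤1⇒m+n≡1 {n = suc k} (s≤s k+1≤m) (s≤s m≤0) with m+n≤o⇒n≤o k (≤-trans k+1≤m m≤0)
... | ()

step-sym : ∀ {n} (G : Graph n) tm {A B} → Step G tm A B → Step G tm B A
step-sym G TAR (inj₁ A+v) = inj₂ A+v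
step-sym G TAR (inj₂ B+v) = inj₁ B+v
step-sym G TJ {A} {B} (∣A∣≡∣B∣ , ∣A∖B∣≡1) =
  sym ∣A∣≡∣B∣ , trans (sym (∣p∣≡∣q∣⇒∣p∩∁q∣≡∣q∩∁p∣ A B ∣A∣≡∣B∣)) ∣A∖B∣≡1

step⇒⊆∪⁅x⁆ : ∀ {n} (G : Graph n) tm {A B} → Step G tm A B → ∃ λ x → A ⊆ B ∪ ⁅ x ⁆
step⇒⊆∪⁅x⁆ G TAR (inj₁ (v , _ , refl)) = v , λ x∈A → p⊆p∪q ⁅ v ⁆ (p⊆p∪q ⁅ v ⁆ x∈A)
step⇒⊆∪⁅x⁆ G TAR (inj₂ (v , _ , refl)) = v , λ x∈A → x∈A
step⇒⊆∪⁅x⁆ G TJ {A} {B} (_ , ∣A∖B∣≡1) with ∣p∣≡1⇒p⊆⁅x⁆ (A ∩ ∁ B) ∣A∖B∣≡1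
... | x , A∖B⊆⁅x⁆ = x , p∩∁q⊆r⇒p⊆q∪r A∖B⊆⁅x⁆

module _ {n : ℕ} (G : Graph n) where
  open Graph G using (adj; irrefl) renaming (sym to adj-sym)

  Adj-sym : ∀ {u v} → Adj G u v → Adj G v u
  Adj-sym {u} {v} e = trans (adj-sym v u) e

  ∈N⇒Adj : ∀ {u v} → v ∈ N G u → Adj G u v
  ∈N⇒Adj {u} {v} v∈Nu = trans (sym (lookup∘tabulate (adj u) v)) ([]=⇒lookup v∈Nu)

  InN[_]? : ∀ X v → Dec (InN[_] G X v)
  InN[ X ]? v = (v ∈? X) ⊎-dec any? (λ u → (u ∈? X) ×-dec (adj u v Bool.≟ true))

  InNL : Subset n → Fin n → Set
  InNL X v = InN[_] G X v ⊎ InL G v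

  InNL? : ∀ X v → Dec (InNL X v)
  InNL? X v = InN[ X ]? v ⊎-dec (degG G v ≟ℕ 1)

  Absorbs : Subset n → Subset n → Set
  Absorbs A B = ∀ w → InN[_] G B w → InNL A w ⊎ (∀ u → Adj G w u → InNL A u)

  -- As w ∉ N[A], no neighbour of w lies in A, so its neighbours in N[A] lie in ∂A.
  ⊆NL⇒InZ : ∀ {A w} → ¬ InN[_] G A w → (∀ u → Adj G w u → InNL A u) → InZ G A w
  ⊆NL⇒InZ {A} ¬w∈N[A] nbhd⊆NL = ¬w∈N[A] , λ u e → [ in∂ u e , inj₁ ] (nbhd⊆NL u e)
    where
    in∂ : ∀ u → Adj G _ u → InN[_] G A u → InL G u ⊎ In∂ G A u
    in∂ u e u∈N[A] = inj₂ (u∈N[A] , λ u∈A → ¬w∈N[A] (inj₂ (u , u∈A , Adj-sym e)))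

  absorbs⇒nbhd⊆NL : ∀ {A B w} → Absorbs A B → InY G B w → ¬ InNL A w →
                     ∀ u → Adj G w u → InNL A u
  absorbs⇒nbhd⊆NL absorbs (inj₁ w∈N[B]) w∉NL with absorbs _ w∈N[B]
  ... | inj₁ w∈NL   = ⊥-elim (w∉NL w∈NL)
  ... | inj₂ nbhd⊆NL = nbhd⊆NL
  absorbs⇒nbhd⊆NL {w = w} absorbs (inj₂ (inj₁ (_ , nbhd⊆L∪∂B))) w∉NL u e
    with nbhd⊆L∪∂B u e
  ... | inj₁ u∈L         = inj₂ u∈L
  ... | inj₂ (u∈N[B] , _) with absorbs u u∈N[B]
  ...   | inj₁ u∈NL     = u∈NL
  ...   | inj₂ nbhd⊆NL  = ⊥-elim (w∉NL (nbhd⊆NL w (Adj-sym e)))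
  absorbs⇒nbhd⊆NL absorbs (inj₂ (inj₂ w∈L)) w∉NL = ⊥-elim (w∉NL (inj₂ w∈L))

  absorbs⇒Y⊆ : ∀ {A B} → Absorbs A B → ∀ w → InY G B w → InY G A w
  absorbs⇒Y⊆ {A} absorbs w w∈Y[B] with InNL? A w
  ... | yes (inj₁ w∈N[A]) = inj₁ w∈N[A]
  ... | yes (inj₂ w∈L)    = inj₂ (inj₂ w∈L)
  ... | no  w∉NL          =
    inj₂ (inj₁ (⊆NL⇒InZ (λ w∈N[A] → w∉NL (inj₁ w∈N[A]))
                        (absorbs⇒nbhd⊆NL absorbs w∈Y[B] w∉NL)))

  sole-attacker⇒leaf : ∀ {X y w} → OffensiveAlliance G X → y ∈ X → Adj G y w → w ∉ X →
                       (∀ {z} → z ∈ X → Adj G z w → z ≡ y) → InL G w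
  sole-attacker⇒leaf {X} {y} {w} oa y∈X e w∉X sole = begin
    ∣ N G w ∣                         ≡⟨ ∣p∣≡∣p∩q∣+∣p∩∁q∣ (N G w) X ⟩
    ∣ N G w ∩ X ∣ + ∣ N G w ∩ ∁ X ∣   ≡⟨ n+1≤m≤1⇒m+n≡1 (oa w (inj₂ (y , y∈X , e) , w∉X)) d≤1 ⟩
    1                                 ∎
    where
    open ≡-Reasoning
    attackers⊆⁅y⁆ : N G w ∩ X ⊆ ⁅ y ⁆
    attackers⊆⁅y⁆ z∈ with x∈p∩q⁻ (N G w) X z∈
    ... | z∈Nw , z∈X = subst (_∈ ⁅ y ⁆) (sym (sole z∈X (Adj-sym (∈N⇒Adj z∈Nw)))) (x∈⁅x⁆ y)
    d≤1 : ∣ N G w ∩ X ∣ ≤ 1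
    d≤1 = subst (∣ N G w ∩ X ∣ ≤_) (∣⁅x⁆∣≡1 y) (p⊆q⇒∣p∣≤∣q∣ attackers⊆⁅y⁆)

  module _ {A B y} (oaB : OffensiveAlliance G B) (B⊆A∪⁅y⁆ : B ⊆ A ∪ ⁅ y ⁆) where

    ∈B⇒∈A⊎≡y : ∀ {z} → z ∈ B → z ∈ A ⊎ z ≡ y
    ∈B⇒∈A⊎≡y z∈B with x∈p∪q⁻ A ⁅ y ⁆ (B⊆A∪⁅y⁆ z∈B)
    ... | inj₁ z∈A = inj₁ z∈A
    ... | inj₂ z∈⁅y⁆ = inj₂ (x∈⁅y⁆⇒x≡y y z∈⁅y⁆)

    nbhd-of-new-vertex⊆NL : y ∈ B → ∀ w → Adj G y w → InNL A w
    nbhd-of-new-vertex⊆NL y∈B w e with InN[ A ]? w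
    ... | yes w∈N[A] = inj₁ w∈N[A]
    ... | no  w∉N[A] = inj₂ (sole-attacker⇒leaf oaB y∈B e w∉B sole)
      where
      w∉B : w ∉ B
      w∉B w∈B with ∈B⇒∈A⊎≡y w∈B
      ... | inj₁ w∈A = w∉N[A] (inj₁ w∈A)
      ... | inj₂ refl with trans (sym e) (irrefl y)
      ...   | ()
      sole : ∀ {z} → z ∈ B → Adj G z w → z ≡ y
      sole z∈B e′ with ∈B⇒∈A⊎≡y z∈B
      ... | inj₁ z∈A = ⊥-elim (w∉N[A] (inj₂ (_ , z∈A , e′)))
      ... | inj₂ z≡y = z≡y

    ⊆∪⁅x⁆⇒absorbs : Absorbs A B
    ⊆∪⁅x⁆⇒absorbs w (inj₁ w∈B) with ∈B⇒∈A⊎≡y w∈B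
    ... | inj₁ w∈A = inj₁ (inj₁ (inj₁ w∈A))
    ... | inj₂ refl = inj₂ (nbhd-of-new-vertex⊆NL w∈B)
    ⊆∪⁅x⁆⇒absorbs w (inj₂ (z , z∈B , e)) with ∈B⇒∈A⊎≡y z∈B
    ... | inj₁ z∈A = inj₁ (inj₁ (inj₂ (z , z∈A , e)))
    ... | inj₂ refl = inj₁ (nbhd-of-new-vertex⊆NL z∈B w e)

  step⇒Y⊆ : ∀ tm {A B} → OffensiveAlliance G A → Step G tm A B → ∀ v → InY G A v → InY G B v
  step⇒Y⊆ tm oaA step with step⇒⊆∪⁅x⁆ G tm step
  ... | _ , A⊆B∪⁅x⁆ = absorbs⇒Y⊆ (⊆∪⁅x⁆⇒absorbs oaA A⊆B∪⁅x⁆)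

  OASeq-head : ∀ {tm A C} → OASeq G tm A C → OffensiveAlliance G A
  OASeq-head (single oa)    = oa
  OASeq-head (cons oa _ _)  = oa

  OASeq⇒Y⊆ : ∀ {tm A C} → OASeq G tm A C → ∀ v → InY G A v → InY G C v
  OASeq⇒Y⊆ (single _)                 v v∈Y = v∈Y
  OASeq⇒Y⊆ {tm} (cons oaA step rest)  v v∈Y = OASeq⇒Y⊆ rest v (step⇒Y⊆ tm oaA step v v∈Y)

  OASeq⇒Y⊇ : ∀ {tm A C} → OASeq G tm A C → ∀ v → InY G C v → InY G A v
  OASeq⇒Y⊇ (single _)               v v∈Y = v∈Y
  OASeq⇒Y⊇ {tm} (cons _ step rest)  v v∈Y =
    step⇒Y⊆ tm (OASeq-head rest) (step-sym G tm step) v (OASeq⇒Y⊇ rest v v∈Y)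

lemma5 : (n : ℕ) (G : Graph n) (tm : TM) (A B : Subset n) →
    OffensiveAlliance G A → OffensiveAlliance G B → OASeq G tm A B →
    (v : Fin n) → (InY G A v → InY G B v) × (InY G B v → InY G A v)
lemma5 n G tm A B _ _ seq v = OASeq⇒Y⊆ G seq v , OASeq⇒Y⊇ G seq v
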